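{- Let $\mathcal{F}$ and $\mathcal{F}'$ be families of finite graphs up to isomorphism with $\mathcal{F}=S(\mathcal{F}')$. Then $\mathcal{F}$ has NIP if and only if $\mathcal{F}'$ has NIP. In particular, if $\mathcal{F}$ is a family of finite graphs closed under substitutions and under induced subgraphs and $\mathcal{P}$ is the family of all prime graphs in $\mathcal{F}$, then $\mathcal{F}$ has NIP if and only if $\mathcal{P}$ has NIP.
   Context: For a graph $G$ with at least one vertex, $\mathrm{VC}(G)$ is the largest size of $U\subseteq V(G)$ such that for every $A\subseteq U$ there is $v\in V(G)$ with $N_G(v)\cap U=A$ ($N_G(v)$ the neighbourhood of $v$); $\mathrm{VC}(K_0)=0$. A family $\mathcal{F}$ has NIP if $\sup\{\mathrm{VC}(G):G\in\mathcal{F}\}<\infty$. The substitution $F_1^{v\to F_2}$ replaces vertex $v$ of $F_1$ by a copy of $F_2$, each of whose vertices is adjacent exactly to the neighbours of $v$ in $F_1$. $S(\mathcal{F}')$ is the smallest family containing $\mathcal{F}'$ closed under substitutions. A graph $F$ is prime if it is not of the form $F_1^{v\to F_2}$ with $|F_1|,|F_2|<|F|$. -}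

module Defs where

open import Data.Nat using (ℕ; zero; suc; _+_; _≤_; _<_; pred)
open import Data.Bool using (Bool; true; false)
open import Data.Fin using (Fin; splitAt; punchIn)
open import Data.Fin.Subset using (Subset; _⊆_; _∩_; ∣_∣)
open import Data.Vec using (tabulate)
open import Data.Sum using (_⊎_; inj₁; inj₂)
open import Data.Product using (Σ; ∃; _×_; _,_)
open import Relation.Binary.PropositionalEquality using (_≡_; refl)
open import Relation.Nullary using (¬_)
open import Function.Bundles using (_↔_; Inverse)
open import Function.Definitions using (Injective)

record Graph : Set where
  field
    n      : ℕ
    adj    : Fin n → Fin n → Bool
    sym    : ∀ i j → adj i j ≡ adj j i
    irrefl : ∀ i → adj i i ≡ false
open Graph public

Family : Set₁
Family = Graph → Set

_≅_ : Graph → Graph → Set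
G ≅ H = Σ (Fin (n G) ↔ Fin (n H)) λ f →
  ∀ i j → adj G i j ≡ adj H (Inverse.to f i) (Inverse.to f j)

IsoClosed : Family → Set
IsoClosed F = ∀ G H → G ≅ H → F G → F H

N : (G : Graph) → Fin (n G) → Subset (n G)
N G v = tabulate (adj G v)

Shatters : (G : Graph) → Subset (n G) → Set
Shatters G U = ∀ (A : Subset (n G)) → A ⊆ U → ∃ λ v → N G v ∩ U ≡ A

VC≤ : Graph → ℕ → Set
VC≤ G d = ∀ (U : Subset (n G)) → Shatters G U → ∣ U ∣ ≤ d

NIP : Family → Set
NIP F = ∃ λ d → ∀ G → F G → VC≤ G d

-- Substitution F₁^{v → F₂}
-- Vertices: Fin (pred n₁ + n₂); the first pred n₁ are the vertices of F₁
-- other than v (via punchIn v), the last n₂ are the copy of F₂.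

substAdjS : (G₁ G₂ : Graph) (m : ℕ) → (Fin (suc m) → Fin (suc m) → Bool) → Fin (suc m) →
            Fin m ⊎ Fin (n G₂) → Fin m ⊎ Fin (n G₂) → Bool
substAdjS G₁ G₂ m a v (inj₂ x) (inj₂ y) = adj G₂ x y
substAdjS G₁ G₂ m a v (inj₁ x) (inj₁ y) = a (punchIn v x) (punchIn v y)
substAdjS G₁ G₂ m a v (inj₁ x) (inj₂ y) = a (punchIn v x) v
substAdjS G₁ G₂ m a v (inj₂ x) (inj₁ y) = a v (punchIn v y)

substAdjS-sym : (G₁ G₂ : Graph) (m : ℕ) (a : Fin (suc m) → Fin (suc m) → Bool) →
  (∀ i j → a i j ≡ a j i) → (v : Fin (suc m)) → ∀ x y →
  substAdjS G₁ G₂ m a v x y ≡ substAdjS G₁ G₂ m a v y x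
substAdjS-sym G₁ G₂ m a s v (inj₂ x) (inj₂ y) = sym G₂ x y
substAdjS-sym G₁ G₂ m a s v (inj₁ x) (inj₁ y) = s _ _
substAdjS-sym G₁ G₂ m a s v (inj₁ x) (inj₂ y) = s _ _
substAdjS-sym G₁ G₂ m a s v (inj₂ x) (inj₁ y) = s _ _

substAdjS-irr : (G₁ G₂ : Graph) (m : ℕ) (a : Fin (suc m) → Fin (suc m) → Bool) →
  (∀ i → a i i ≡ false) → (v : Fin (suc m)) → ∀ x →
  substAdjS G₁ G₂ m a v x x ≡ false
substAdjS-irr G₁ G₂ m a r v (inj₂ x) = irrefl G₂ x
substAdjS-irr G₁ G₂ m a r v (inj₁ x) = r _

record SubstData (G₁ G₂ : Graph) (k : ℕ) : Set where
  field
    sadj : Fin (pred k + n G₂) → Fin (pred k + n G₂) → Bool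
    ssym : ∀ i j → sadj i j ≡ sadj j i
    sirr : ∀ i → sadj i i ≡ false

mkSubst : (G₁ G₂ : Graph) (k : ℕ) (a : Fin k → Fin k → Bool) →
  (∀ i j → a i j ≡ a j i) → (∀ i → a i i ≡ false) → Fin k → SubstData G₁ G₂ k
mkSubst G₁ G₂ (suc m) a s r v = record
  { sadj = λ i j → substAdjS G₁ G₂ m a v (splitAt m i) (splitAt m j)
  ; ssym = λ i j → substAdjS-sym G₁ G₂ m a s v (splitAt m i) (splitAt m j)
  ; sirr = λ i → substAdjS-irr G₁ G₂ m a r v (splitAt m i)
  }

subst : (G₁ : Graph) → Fin (n G₁) → Graph → Graph
subst G₁ v G₂ = record
  { n = pred (n G₁) + n G₂
  ; adj = SubstData.sadj D
  ; sym = SubstData.ssym D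
  ; irrefl = SubstData.sirr D
  }
  where D = mkSubst G₁ G₂ (n G₁) (adj G₁) (sym G₁) (irrefl G₁) v

data S (F' : Family) : Family where
  base : ∀ {G} → F' G → S F' G
  iso  : ∀ {G H} → G ≅ H → S F' G → S F' H
  sub  : ∀ {G₁ G₂} (v : Fin (n G₁)) → S F' G₁ → S F' G₂ → S F' (subst G₁ v G₂)

SubstClosed : Family → Set
SubstClosed F = ∀ G₁ G₂ (v : Fin (n G₁)) → F G₁ → F G₂ → F (subst G₁ v G₂)

induced : (G : Graph) (k : ℕ) (f : Fin k → Fin (n G)) → Graph
induced G k f = record
  { n = k
  ; adj = λ i j → adj G (f i) (f j)
  ; sym = λ i j → sym G (f i) (f j)
  ; irrefl = λ i → irrefl G (f i)
  }

InducedClosed : Family → Set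
InducedClosed F = ∀ G (k : ℕ) (f : Fin k → Fin (n G)) →
  Injective _≡_ _≡_ f → F G → F (induced G k f)

Prime : Graph → Set
Prime G = ¬ (∃ λ G₁ → ∃ λ (v : Fin (n G₁)) → ∃ λ G₂ →
  n G₁ < n G × n G₂ < n G × G ≅ subst G₁ v G₂)

module Submission where

-- Call a sequence of vertices weakly shattered if every nonconstant pattern on it
-- is realized by a vertex that may disregard its own position. If no d + 1
-- vertices are shattered, no weakly shattered sequence is longer than 2d + 2,
-- since of a longer one the first d + 1 vertices are shattered. Weak shattering
-- loses nothing under substitution: a weakly shattered sequence of F₁^{v→F₂}
-- cannot meet the module F₂ twice and also leave it, so it is either a sequence
-- of F₂ or collapses injectively onto a sequence of F₁. Hence S(F′) is bounded
-- when F′ is; for the second statement induct on the size of the graph, a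
-- non-prime member of F being a substitution of two smaller induced subgraphs.

open import Defs hiding (sym)
open import Data.Bool using (Bool; true; false; _∧_; not)
import Data.Bool as Bool
open import Data.Bool.Properties using (∧-identityʳ; ∧-zeroʳ)
open import Data.Empty using (⊥; ⊥-elim)
open import Data.Fin using (Fin; zero; suc; _↑ˡ_; _↑ʳ_; splitAt; join; punchIn; punchOut)
open import Data.Fin.Properties
  using (_≟_; any?; all?; ¬∀⟶∃¬; injective⇒≤; suc-injective; ↑ˡ-injective; ↑ʳ-injective;
         splitAt-↑ˡ; splitAt-↑ʳ; splitAt⁻¹-↑ʳ; join-splitAt;
         punchIn-injective; punchInᵢ≢i; punchIn-punchOut)
open import Data.Fin.Subset using (Subset; _∈_; _⊆_; _∩_; ∣_∣)
open import Data.Fin.Subset.Properties using (_∈?_)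
open import Data.Nat using (ℕ; zero; suc; _+_; _≤_; _<_; pred; z≤n; s≤s; _≤?_)
open import Data.Nat.Properties
  using (≤-trans; ≤-reflexive; 1+n≰n; <⇒≤; <⇒≱; ≰⇒>; m≤m+n; +-cancelˡ-<; +-identityʳ; pred[n]≤n;
         m≤n⇒∃[o]m+o≡n)
open import Data.Nat.Induction using (<-wellFounded)
open import Data.Fin.Permutation using (↔⇒≡)
open import Induction.WellFounded using (module All)
open import Relation.Binary.Construct.On as On using ()
open import Data.Product using (∃; _×_; _,_; proj₁; proj₂)
open import Data.Sum using (_⊎_; inj₁; inj₂; [_,_]′)
open import Data.Vec using ([]; _∷_; here; there; lookup; tabulate)
open import Data.Vec.Properties using (lookup∘tabulate; lookup-zipWith; []=⇒lookup; lookup⇒[]=)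
open import Data.Vec.Relation.Binary.Pointwise.Extensional using (ext; Pointwise-≡⇒≡)
open import Function using (_∘_; _⇔_; mk⇔)
open import Function.Bundles using (Inverse; Injection; Equivalence)
open import Function.Properties.Inverse using (↔-sym; Inverse⇒Injection)
open import Function.Definitions using (Injective)
open import Relation.Binary.PropositionalEquality
  using (_≡_; _≢_; refl; sym; trans; cong; cong₂; module ≡-Reasoning)
import Relation.Binary.PropositionalEquality as ≡
open import Relation.Nullary using (¬_; ¬?; Stable; Dec; yes; no; does; contradiction)
open import Relation.Nullary.Decidable using (dec-true; dec-false; decidable-stable; _×-dec_)

Pattern : ℕ → Set
Pattern k = Fin k → Bool

Nontrivial : ∀ {k} → Pattern k → Set
Nontrivial A = (∃ λ j → A j ≡ true) × (∃ λ j → A j ≡ false)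

Shattered : (G : Graph) {k : ℕ} → (Fin k → Fin (n G)) → Set
Shattered G {k} e = ∀ (A : Pattern k) → ∃ λ x → ∀ j → adj G x (e j) ≡ A j

-- x is allowed to ignore its own position in the sequence: its neighbourhood
-- may be read as open or as closed.
Realizes : (G : Graph) {k : ℕ} → (Fin k → Fin (n G)) → Pattern k → Fin (n G) → Set
Realizes G e A x = ∀ j → e j ≢ x → adj G x (e j) ≡ A j

WeaklyShattered : (G : Graph) {k : ℕ} → (Fin k → Fin (n G)) → Set
WeaklyShattered G {k} e = ∀ (A : Pattern k) → Nontrivial A → ∃ (Realizes G e A)

ShatterBound : Graph → ℕ → Set
ShatterBound G d = ∀ {k} (e : Fin k → Fin (n G)) → Injective _≡_ _≡_ e → Shattered G e → k ≤ d

WeakShatterBound : Graph → ℕ → Set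
WeakShatterBound G d =
  ∀ {k} (e : Fin k → Fin (n G)) → Injective _≡_ _≡_ e → WeaklyShattered G e → k ≤ d

shattered⇒weaklyShattered : ∀ {G k} {e : Fin k → Fin (n G)} → Shattered G e → WeaklyShattered G e
shattered⇒weaklyShattered shattered A _ = let x , realizes = shattered A in x , λ j _ → realizes j

weakShatterBound⇒shatterBound : ∀ {G d} → WeakShatterBound G d → ShatterBound G d
weakShatterBound⇒shatterBound {G} bound e e-inj = bound e e-inj ∘ shattered⇒weaklyShattered {G}

record Enumeration {m} (U : Subset m) : Set where
  field
    at         : Fin ∣ U ∣ → Fin m
    injective  : Injective _≡_ _≡_ at
    at∈        : ∀ j → at j ∈ U
    surjective : ∀ {i} → i ∈ U → ∃ λ j → at j ≡ i

enumerate : ∀ {m} (U : Subset m) → Enumeration U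
enumerate [] = record { at = λ () ; injective = λ { {()} } ; at∈ = λ () ; surjective = λ () }
enumerate (false ∷ U) = record
  { at = suc ∘ at
  ; injective = injective ∘ suc-injective
  ; at∈ = there ∘ at∈
  ; surjective = λ { (there i∈U) → let j , atj≡i = surjective i∈U in j , cong suc atj≡i }
  }
  where open Enumeration (enumerate U)
enumerate (true ∷ U) = record { at = at′ ; injective = injective′ ; at∈ = at∈′ ; surjective = surjective′ }
  where
  open Enumeration (enumerate U)
  at′ : Fin (suc ∣ U ∣) → Fin (suc _)
  at′ zero = zero
  at′ (suc j) = suc (at j)
  injective′ : Injective _≡_ _≡_ at′
  injective′ {zero} {zero} _ = refl
  injective′ {suc j} {suc j′} eq = cong suc (injective (suc-injective eq))
  at∈′ : ∀ j → at′ j ∈ true ∷ U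
  at∈′ zero = here
  at∈′ (suc j) = there (at∈ j)
  surjective′ : ∀ {i} → i ∈ true ∷ U → ∃ λ j → at′ j ≡ i
  surjective′ here = zero , refl
  surjective′ (there i∈U) = let j , atj≡i = surjective i∈U in suc j , cong suc atj≡i

lookup-N∩ : ∀ G x (U : Subset (n G)) i → lookup (N G x ∩ U) i ≡ adj G x i ∧ lookup U i
lookup-N∩ G x U i = trans (lookup-zipWith _∧_ i (N G x) U) (cong (_∧ lookup U i) (lookup∘tabulate (adj G x) i))

decSubset : ∀ {m} {P : Fin m → Set} → (∀ i → Dec (P i)) → Subset m
decSubset P? = tabulate (does ∘ P?)

∈-decSubset⁺ : ∀ {m} {P : Fin m → Set} (P? : ∀ i → Dec (P i)) {i} → P i → i ∈ decSubset P?
∈-decSubset⁺ P? {i} p = lookup⇒[]= i _ (trans (lookup∘tabulate (does ∘ P?) i) (dec-true (P? i) p))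

∈-decSubset⁻ : ∀ {m} {P : Fin m → Set} (P? : ∀ i → Dec (P i)) {i} → i ∈ decSubset P? → P i
∈-decSubset⁻ P? {i} i∈ with P? i | trans (sym (lookup∘tabulate (does ∘ P?) i)) ([]=⇒lookup i∈)
... | yes p | _ = p
... | no _ | ()

∉⇒lookup≡false : ∀ {m} {i : Fin m} {U : Subset m} → ¬ i ∈ U → lookup U i ≡ false
∉⇒lookup≡false {i = i} {U} i∉U with lookup U i in eq
... | true = contradiction (lookup⇒[]= i U eq) i∉U
... | false = refl

VC≤⇒shatterBound : ∀ {G d} → VC≤ G d → ShatterBound G d
VC≤⇒shatterBound {G} {d} vc {k} e e-inj shattered = ≤-trans (injective⇒≤ index-injective) (vc U U-shattered)
  where
  image? : ∀ i → Dec (∃ λ j → e j ≡ i)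
  image? i = any? λ j → e j ≟ i
  U : Subset (n G)
  U = decSubset image?
  open Enumeration (enumerate U)
  index : Fin k → Fin ∣ U ∣
  index j = proj₁ (surjective (∈-decSubset⁺ image? (j , refl)))
  index-injective : Injective _≡_ _≡_ index
  index-injective {j} {j′} eq = e-inj (begin
    e j            ≡⟨ sym (proj₂ (surjective (∈-decSubset⁺ image? (j , refl)))) ⟩
    at (index j)   ≡⟨ cong at eq ⟩
    at (index j′)  ≡⟨ proj₂ (surjective (∈-decSubset⁺ image? (j′ , refl))) ⟩
    e j′           ∎)
    where open ≡-Reasoning
  U-shattered : Shatters G U
  U-shattered A A⊆U = x , Pointwise-≡⇒≡ (ext λ i → trans (lookup-N∩ G x U i) (agree i))
    where
    x = proj₁ (shattered (λ j → lookup A (e j)))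
    agree : ∀ i → adj G x i ∧ lookup U i ≡ lookup A i
    agree i with i ∈? U
    ... | no i∉U = trans (cong (adj G x i ∧_) (∉⇒lookup≡false i∉U))
                         (trans (∧-zeroʳ _) (sym (∉⇒lookup≡false (i∉U ∘ A⊆U))))
    ... | yes i∈U with ∈-decSubset⁻ image? i∈U
    ...   | j , refl =
      trans (cong (adj G x i ∧_) ([]=⇒lookup i∈U))
            (trans (∧-identityʳ _) (proj₂ (shattered (λ j → lookup A (e j))) j))

shatterBound⇒VC≤ : ∀ {G d} → ShatterBound G d → VC≤ G d
shatterBound⇒VC≤ {G} bound U U-shattered = bound at injective at-shattered
  where
  open Enumeration (enumerate U)
  at-shattered : Shattered G at
  at-shattered A = x , realizes
    where
    selected? : ∀ i → Dec (∃ λ j → at j ≡ i × A j ≡ true)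
    selected? i = any? λ j → (at j ≟ i) ×-dec (A j Bool.≟ true)
    A′ : Subset (n G)
    A′ = decSubset selected?
    A′⊆U : A′ ⊆ U
    A′⊆U i∈A′ = let j , atj≡i , _ = ∈-decSubset⁻ selected? i∈A′ in ≡.subst (_∈ U) atj≡i (at∈ j)
    x = proj₁ (U-shattered A′ A′⊆U)
    selected-at : ∀ j → does (selected? (at j)) ≡ A j
    selected-at j with A j in Aj
    ... | true = dec-true (selected? (at j)) (j , refl , Aj)
    ... | false = dec-false (selected? (at j)) λ (j′ , atj′≡atj , Aj′) →
      contradiction (trans (sym Aj′) (trans (cong A (injective atj′≡atj)) Aj)) λ ()
    realizes : ∀ j → adj G x (at j) ≡ A j
    realizes j = begin
      adj G x (at j)                    ≡⟨ sym (∧-identityʳ _) ⟩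
      adj G x (at j) ∧ true             ≡⟨ cong (adj G x (at j) ∧_) ([]=⇒lookup (at∈ j)) ⟨
      adj G x (at j) ∧ lookup U (at j)  ≡⟨ lookup-N∩ G x U (at j) ⟨
      lookup (N G x ∩ U) (at j)         ≡⟨ cong (λ V → lookup V (at j)) (proj₂ (U-shattered A′ A′⊆U)) ⟩
      lookup A′ (at j)                  ≡⟨ lookup∘tabulate (does ∘ selected?) (at j) ⟩
      does (selected? (at j))           ≡⟨ selected-at j ⟩
      A j                               ∎
      where open ≡-Reasoning

indicator : ∀ {t} → Fin t → Pattern t
indicator l l′ = does (l′ ≟ l)

indicator-true⇒≡ : ∀ {t} {l l′ : Fin t} → indicator l l′ ≡ true → l′ ≡ l
indicator-true⇒≡ {l = l} {l′} eq with l′ ≟ l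
... | yes l′≡l = l′≡l
... | no _ = contradiction eq λ ()

another : ∀ {t} → 2 ≤ t → (l : Fin t) → ∃ λ l′ → l′ ≢ l
another {suc (suc _)} _ zero = suc zero , λ ()
another {suc (suc _)} _ (suc _) = zero , λ ()
another {suc zero} (s≤s ()) _

↑ˡ≢↑ʳ : ∀ {p t} (j : Fin p) (l : Fin t) → j ↑ˡ t ≢ p ↑ʳ l
↑ˡ≢↑ʳ {p} {t} j l eq with trans (sym (splitAt-↑ˡ p j t)) (trans (cong (splitAt p) eq) (splitAt-↑ʳ p t l))
... | ()

-- Take the realizers of A extended by each of the t singletons of the suffix. One
-- lying in the prefix has that singleton as its row on the suffix, so if all of
-- them lay in the prefix they would give an injection of the suffix into it.
prefix-shattered : ∀ {G p t} (e : Fin (p + t) → Fin (n G)) → Injective _≡_ _≡_ e →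
  WeaklyShattered G e → p < t → 2 ≤ t → Shattered G (λ j → e (j ↑ˡ t))
prefix-shattered {G} {p} {t} e e-inj e-ws p<t 2≤t A = realizing (all? (inPrefix? ∘ realizer))
  where
  B : Fin t → Pattern (p + t)
  B l = [ A , indicator l ]′ ∘ splitAt p
  B-prefix : ∀ l j → B l (j ↑ˡ t) ≡ A j
  B-prefix l j = cong [ A , indicator l ]′ (splitAt-↑ˡ p j t)
  B-suffix : ∀ l l′ → B l (p ↑ʳ l′) ≡ indicator l l′
  B-suffix l l′ = cong [ A , indicator l ]′ (splitAt-↑ʳ p t l′)
  B-nontrivial : ∀ l → Nontrivial (B l)
  B-nontrivial l = let l′ , l′≢l = another 2≤t l in
    (p ↑ʳ l , trans (B-suffix l l) (dec-true (l ≟ l) refl)) ,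
    (p ↑ʳ l′ , trans (B-suffix l l′) (dec-false (l′ ≟ l) l′≢l))
  realizer : Fin t → Fin (n G)
  realizer l = proj₁ (e-ws (B l) (B-nontrivial l))
  realizes : ∀ l → Realizes G e (B l) (realizer l)
  realizes l = proj₂ (e-ws (B l) (B-nontrivial l))
  inPrefix? : ∀ x → Dec (∃ λ j → e (j ↑ˡ t) ≡ x)
  inPrefix? x = any? λ j → e (j ↑ˡ t) ≟ x
  realizing : Dec (∀ l → ∃ λ j → e (j ↑ˡ t) ≡ realizer l) →
              ∃ λ x → ∀ j → adj G x (e (j ↑ˡ t)) ≡ A j
  realizing (yes all-in) = contradiction (injective⇒≤ row-injective) (<⇒≱ p<t)
    where
    row : Fin t → Fin p
    row l = proj₁ (all-in l)
    realizer-row : ∀ l l′ → adj G (realizer l) (e (p ↑ʳ l′)) ≡ indicator l l′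
    realizer-row l l′ =
      trans (realizes l (p ↑ʳ l′) λ eq → ↑ˡ≢↑ʳ (row l) l′ (e-inj (trans (proj₂ (all-in l)) (sym eq))))
            (B-suffix l l′)
    row-injective : Injective _≡_ _≡_ row
    row-injective {l} {l′} eq = indicator-true⇒≡ (begin
      indicator l′ l                    ≡⟨ realizer-row l′ l ⟨
      adj G (realizer l′) (e (p ↑ʳ l))  ≡⟨ cong (λ x → adj G x (e (p ↑ʳ l))) same-realizer ⟩
      adj G (realizer l) (e (p ↑ʳ l))   ≡⟨ realizer-row l l ⟩
      indicator l l                     ≡⟨ dec-true (l ≟ l) refl ⟩
      true                              ∎)
      where
      open ≡-Reasoning
      same-realizer : realizer l′ ≡ realizer l
      same-realizer =
        trans (sym (proj₂ (all-in l′))) (trans (cong (λ j → e (j ↑ˡ t)) (sym eq)) (proj₂ (all-in l)))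
  realizing (no ¬all-in) = let l , l-outside = ¬∀⟶∃¬ t _ (inPrefix? ∘ realizer) ¬all-in in
    realizer l , λ j → trans (realizes l (j ↑ˡ t) λ eq → l-outside (j , eq)) (B-prefix l j)

shatterBound⇒weakShatterBound : ∀ {G d} → ShatterBound G d → WeakShatterBound G (suc d + suc d)
shatterBound⇒weakShatterBound {G} {d} bound {k} e e-inj e-ws with k ≤? suc d + suc d
... | yes k≤2d+2 = k≤2d+2
... | no k≰2d+2 with m≤n⇒∃[o]m+o≡n (≤-trans (m≤m+n (suc d) (suc d)) (<⇒≤ (≰⇒> k≰2d+2)))
...   | t , refl = contradiction (bound (λ j → e (j ↑ˡ t)) (↑ˡ-injective t _ _ ∘ e-inj)
                                   (prefix-shattered {G} e e-inj e-ws d<t (≤-trans (s≤s (s≤s z≤n)) d<t))) 1+n≰n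
  where
  d<t : suc d < t
  d<t = +-cancelˡ-< (suc d) (suc d) t (≰⇒> k≰2d+2)

record Embedding (G H : Graph) : Set where
  field
    map       : Fin (n G) → Fin (n H)
    injective : Injective _≡_ _≡_ map
    adj-map   : ∀ x y → adj H (map x) (map y) ≡ adj G x y

Collapsing : (H G : Graph) → (Fin (n H) → Fin (n G)) → Set
Collapsing H G π = ∀ x y → π x ≢ π y → adj H x y ≡ adj G (π x) (π y)

weaklyShattered-collapse : ∀ {H G k} {π : Fin (n H) → Fin (n G)} → Collapsing H G π →
  {e : Fin k → Fin (n H)} → WeaklyShattered H e → WeaklyShattered G (π ∘ e)
weaklyShattered-collapse {π = π} collapsing {e} e-ws A A-nontrivial =
  let x , realizes = e-ws A A-nontrivial in
  π x , λ j πej≢πx → trans (sym (collapsing x (e j) (πej≢πx ∘ sym))) (realizes j (πej≢πx ∘ cong π))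

weakShatterBound-embedding : ∀ {G H d} → Embedding G H → WeakShatterBound H d → WeakShatterBound G d
weakShatterBound-embedding {G} {H} f bound e e-inj e-ws =
  bound (map ∘ e) (e-inj ∘ injective) (weaklyShattered-collapse {G} {H} (λ x y _ → sym (adj-map x y)) e-ws)
  where open Embedding f

≅⇒embedding : ∀ {G H} → G ≅ H → Embedding G H
≅⇒embedding (f , adj-to) = record
  { map = Inverse.to f
  ; injective = Injection.injective (Inverse⇒Injection f)
  ; adj-map = λ x y → sym (adj-to x y)
  }

≅-sym : ∀ {G H} → G ≅ H → H ≅ G
≅-sym {G} {H} (f , adj-to) = ↔-sym f , λ x y →
  sym (trans (adj-to _ _) (cong₂ (adj H) (Inverse.strictlyInverseˡ f x) (Inverse.strictlyInverseˡ f y)))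

section⇒embedding : ∀ {H G} {π : Fin (n H) → Fin (n G)} → Collapsing H G π →
  (s : Fin (n G) → Fin (n H)) → (∀ w → π (s w) ≡ w) → Embedding G H
section⇒embedding {H} {G} {π} collapsing s π∘s≡id = record
  { map = s
  ; injective = λ {w} {w′} eq → trans (sym (π∘s≡id w)) (trans (cong π eq) (π∘s≡id w′))
  ; adj-map = adj-s
  }
  where
  adj-s : ∀ w w′ → adj H (s w) (s w′) ≡ adj G w w′
  adj-s w w′ with w ≟ w′
  ... | yes refl = trans (irrefl H (s w)) (sym (irrefl G w))
  ... | no w≢w′ =
    trans (collapsing (s w) (s w′) λ eq → w≢w′ (trans (sym (π∘s≡id w)) (trans eq (π∘s≡id w′))))
          (cong₂ (adj G) (π∘s≡id w) (π∘s≡id w′))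

InImage : ∀ {m k} → (Fin m → Fin k) → Fin k → Set
InImage f x = ∃ λ y → f y ≡ x

inImage? : ∀ {m k} (f : Fin m → Fin k) → ∀ x → Dec (InImage f x)
inImage? f x = any? λ y → f y ≟ x

-- An abstract form of H ≅ G₁^{v→G₂}: the copy of G₂ is a module of H, and
-- collapsing it to a point gives G₁.
record IsSubstitution (H G₁ G₂ : Graph) : Set where
  field
    inner              : Embedding G₂ H
    inner-module       : ∀ {x u u′} → ¬ InImage (Embedding.map inner) x →
                         InImage (Embedding.map inner) u → InImage (Embedding.map inner) u′ →
                         adj H x u ≡ adj H x u′
    collapse           : Fin (n H) → Fin (n G₁)
    collapsing         : Collapsing H G₁ collapse
    collapse-injective : ∀ {x x′} → collapse x ≡ collapse x′ →
                         x ≡ x′ ⊎ InImage (Embedding.map inner) x × InImage (Embedding.map inner) x′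

module _ {H G₁ G₂ : Graph} (decomposition : IsSubstitution H G₁ G₂) where

  open IsSubstitution decomposition
  open Embedding inner

  Inside : Fin (n H) → Set
  Inside = InImage map

  weaklyShattered-inside : ∀ {k} {e : Fin k → Fin (n H)} (e₂ : Fin k → Fin (n G₂)) →
    (∀ j → map (e₂ j) ≡ e j) → WeaklyShattered H e → WeaklyShattered G₂ e₂
  weaklyShattered-inside {e = e} e₂ map∘e₂≡e e-ws A A-nontrivial = realizing (inImage? map x)
    where
    x = proj₁ (e-ws A A-nontrivial)
    realizes : Realizes H e A x
    realizes = proj₂ (e-ws A A-nontrivial)
    inside : ∀ j → Inside (e j)
    inside j = e₂ j , map∘e₂≡e j
    open ≡-Reasoning
    realizing : Dec (Inside x) → ∃ (Realizes G₂ e₂ A)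
    realizing (yes (y , y↦x)) = y , λ j e₂j≢y → begin
      adj G₂ y (e₂ j)             ≡⟨ adj-map y (e₂ j) ⟨
      adj H (map y) (map (e₂ j))  ≡⟨ cong₂ (adj H) y↦x (map∘e₂≡e j) ⟩
      adj H x (e j)               ≡⟨ realizes j (e₂j≢y ∘ injective ∘ pulled-back j) ⟩
      A j                         ∎
      where
      pulled-back : ∀ j → e j ≡ x → map (e₂ j) ≡ map y
      pulled-back j ej≡x = trans (map∘e₂≡e j) (trans ej≡x (sym y↦x))
    realizing (no x-outside) = contradiction (begin
      true            ≡⟨ proj₂ (proj₁ A-nontrivial) ⟨
      A j₁            ≡⟨ realizes j₁ (outside≢ j₁) ⟨
      adj H x (e j₁)  ≡⟨ inner-module x-outside (inside j₁) (inside j₀) ⟩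
      adj H x (e j₀)  ≡⟨ realizes j₀ (outside≢ j₀) ⟩
      A j₀            ≡⟨ proj₂ (proj₂ A-nontrivial) ⟩
      false           ∎) λ ()
      where
      j₁ = proj₁ (proj₁ A-nontrivial)
      j₀ = proj₁ (proj₂ A-nontrivial)
      outside≢ : ∀ j → e j ≢ x
      outside≢ j ej≡x = x-outside (≡.subst Inside ej≡x (inside j))

  -- A realizer outside the module cannot separate e j₁ from e j₂, so every
  -- realizer of a pattern separating them lies in the module and hence sees e j₃
  -- as e j₃ sees e j₁; this fixes the value of the pattern at j₃.
  weaklyShattered-¬straddle : ∀ {k} {e : Fin k → Fin (n H)} → WeaklyShattered H e →
    ∀ {j₁ j₂ j₃} → j₁ ≢ j₂ → Inside (e j₁) → Inside (e j₂) → ¬ Inside (e j₃) → ⊥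
  weaklyShattered-¬straddle {e = e} e-ws {j₁} {j₂} {j₃} j₁≢j₂ in₁ in₂ out₃ = contradiction (begin
    false                ≡⟨ dec-false (j₃ ≟ j₁) (j₃≢ in₁) ⟨
    C₁ j₃                ≡⟨ forced C₁ (dec-true (j₁ ≟ j₁) refl) (dec-false (j₂ ≟ j₁) (j₁≢j₂ ∘ sym)) ⟩
    adj H (e j₃) (e j₁)  ≡⟨ forced C₂ (cong not (dec-false (j₁ ≟ j₂) j₁≢j₂))
                                     (cong not (dec-true (j₂ ≟ j₂) refl)) ⟨
    C₂ j₃                ≡⟨ cong not (dec-false (j₃ ≟ j₂) (j₃≢ in₂)) ⟩
    true                 ∎) λ ()
    where
    C₁ C₂ : Pattern _
    C₁ = indicator j₁
    C₂ = not ∘ indicator j₂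
    open ≡-Reasoning
    outside≢inside : ∀ {x u} → ¬ Inside x → Inside u → u ≢ x
    outside≢inside x-out u-in u≡x = x-out (≡.subst Inside u≡x u-in)
    j₃≢ : ∀ {j} → Inside (e j) → j₃ ≢ j
    j₃≢ in-j j₃≡j = outside≢inside out₃ in-j (cong e (sym j₃≡j))
    forced : ∀ C → C j₁ ≡ true → C j₂ ≡ false → C j₃ ≡ adj H (e j₃) (e j₁)
    forced C C₁≡true C₂≡false with e-ws C ((j₁ , C₁≡true) , (j₂ , C₂≡false))
    ... | x , realizes with inImage? map x
    ...   | no x-out = contradiction (begin
      true            ≡⟨ C₁≡true ⟨
      C j₁            ≡⟨ realizes j₁ (outside≢inside x-out in₁) ⟨
      adj H x (e j₁)  ≡⟨ inner-module x-out in₁ in₂ ⟩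
      adj H x (e j₂)  ≡⟨ realizes j₂ (outside≢inside x-out in₂) ⟩
      C j₂            ≡⟨ C₂≡false ⟩
      false           ∎) λ ()
    ...   | yes x-in = begin
      C j₃                ≡⟨ realizes j₃ (outside≢inside out₃ x-in ∘ sym) ⟨
      adj H x (e j₃)      ≡⟨ Graph.sym H x (e j₃) ⟩
      adj H (e j₃) x      ≡⟨ inner-module out₃ x-in in₁ ⟩
      adj H (e j₃) (e j₁) ∎

  -- A weakly shattered sequence either lies in the module or meets it at most
  -- once; in the latter case collapsing the module keeps it injective.
  weakShatterBound-substitution : ∀ {d} → WeakShatterBound G₁ d → WeakShatterBound G₂ d →
                                  WeakShatterBound H d
  weakShatterBound-substitution bound₁ bound₂ {k} e e-inj e-ws
    with any? (λ j₁ → any? λ j₂ → ¬? (j₁ ≟ j₂) ×-dec (inImage? map (e j₁) ×-dec inImage? map (e j₂)))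
  ... | no ¬twice =
    bound₁ (collapse ∘ e) collapse∘e-injective (weaklyShattered-collapse {H} {G₁} collapsing e-ws)
    where
    collapse∘e-injective : Injective _≡_ _≡_ (collapse ∘ e)
    collapse∘e-injective {i} {j} eq with collapse-injective eq | i ≟ j
    ... | inj₁ ei≡ej          | _       = e-inj ei≡ej
    ... | inj₂ _              | yes i≡j = i≡j
    ... | inj₂ (in-i , in-j)  | no i≢j  = contradiction (i , j , i≢j , in-i , in-j) ¬twice
  ... | yes (j₁ , j₂ , j₁≢j₂ , in₁ , in₂) with all? (inImage? map ∘ e)
  ...   | yes all-in =
    bound₂ (proj₁ ∘ all-in) e₂-injective (weaklyShattered-inside (proj₁ ∘ all-in) (proj₂ ∘ all-in) e-ws)
    where
    e₂-injective : Injective _≡_ _≡_ (proj₁ ∘ all-in)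
    e₂-injective {i} {j} eq = e-inj (trans (sym (proj₂ (all-in i))) (trans (cong map eq) (proj₂ (all-in j))))
  ...   | no ¬all-in = let _ , out₃ = ¬∀⟶∃¬ k _ (inImage? map ∘ e) ¬all-in in
    ⊥-elim (weaklyShattered-¬straddle e-ws j₁≢j₂ in₁ in₂ out₃)

module SubstitutionStructure {m : ℕ} (a : Fin (suc m) → Fin (suc m) → Bool) (a-sym : ∀ i j → a i j ≡ a j i)
                             (a-irrefl : ∀ i → a i i ≡ false) (G₂ : Graph) (v : Fin (suc m)) where

  G₁ : Graph
  G₁ = record { n = suc m ; adj = a ; sym = a-sym ; irrefl = a-irrefl }

  H : Graph
  H = subst G₁ v G₂

  adj⊎ : Fin m ⊎ Fin (n G₂) → Fin m ⊎ Fin (n G₂) → Bool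
  adj⊎ = substAdjS G₁ G₂ m a v

  collapse⊎ : Fin m ⊎ Fin (n G₂) → Fin (suc m)
  collapse⊎ = [ punchIn v , (λ _ → v) ]′

  splitAt-injective : Injective _≡_ _≡_ (splitAt m {n G₂})
  splitAt-injective {x} {x′} eq =
    trans (sym (join-splitAt m (n G₂) x)) (trans (cong (join m (n G₂)) eq) (join-splitAt m (n G₂) x′))

  inner : Embedding G₂ H
  inner = record
    { map = m ↑ʳ_
    ; injective = ↑ʳ-injective m _ _
    ; adj-map = λ y y′ → cong₂ adj⊎ (splitAt-↑ʳ m _ y) (splitAt-↑ʳ m _ y′)
    }

  Inner : Fin (m + n G₂) → Set
  Inner = InImage (Embedding.map inner)

  outside⇒outer : ∀ {x} → ¬ Inner x → ∃ λ z → splitAt m x ≡ inj₁ z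
  outside⇒outer {x} x-out with splitAt m x in eq
  ... | inj₁ z = z , refl
  ... | inj₂ y = contradiction (y , splitAt⁻¹-↑ʳ eq) x-out

  inner-module : ∀ {x u u′} → ¬ Inner x → Inner u → Inner u′ → adj H x u ≡ adj H x u′
  inner-module x-out (y , refl) (y′ , refl) =
    let _ , x-outer = outside⇒outer x-out in
    trans (cong₂ adj⊎ x-outer (splitAt-↑ʳ m _ y)) (sym (cong₂ adj⊎ x-outer (splitAt-↑ʳ m _ y′)))

  collapse : Fin (m + n G₂) → Fin (suc m)
  collapse = collapse⊎ ∘ splitAt m

  collapsing⊎ : ∀ u w → collapse⊎ u ≢ collapse⊎ w → adj⊎ u w ≡ a (collapse⊎ u) (collapse⊎ w)
  collapsing⊎ (inj₁ _) (inj₁ _) _ = refl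
  collapsing⊎ (inj₁ _) (inj₂ _) _ = refl
  collapsing⊎ (inj₂ _) (inj₁ _) _ = refl
  collapsing⊎ (inj₂ _) (inj₂ _) v≢v = contradiction refl v≢v

  collapse⊎-injective : ∀ u w → collapse⊎ u ≡ collapse⊎ w →
    u ≡ w ⊎ (∃ λ y → u ≡ inj₂ y) × (∃ λ y → w ≡ inj₂ y)
  collapse⊎-injective (inj₁ z) (inj₁ z′) eq = inj₁ (cong inj₁ (punchIn-injective v z z′ eq))
  collapse⊎-injective (inj₁ z) (inj₂ _) eq = contradiction eq (punchInᵢ≢i v z)
  collapse⊎-injective (inj₂ _) (inj₁ z′) eq = contradiction (sym eq) (punchInᵢ≢i v z′)
  collapse⊎-injective (inj₂ y) (inj₂ y′) _ = inj₂ ((y , refl) , (y′ , refl))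

  collapse-injective : ∀ {x x′} → collapse x ≡ collapse x′ → x ≡ x′ ⊎ Inner x × Inner x′
  collapse-injective {x} {x′} eq with collapse⊎-injective (splitAt m x) (splitAt m x′) eq
  ... | inj₁ same = inj₁ (splitAt-injective same)
  ... | inj₂ ((y , x-inner) , (y′ , x′-inner)) =
    inj₂ ((y , splitAt⁻¹-↑ʳ x-inner) , (y′ , splitAt⁻¹-↑ʳ x′-inner))

  isSubstitution : IsSubstitution H G₁ G₂
  isSubstitution = record
    { inner = inner
    ; inner-module = inner-module
    ; collapse = collapse
    ; collapsing = λ x y → collapsing⊎ (splitAt m x) (splitAt m y)
    ; collapse-injective = collapse-injective
    }

  section : Fin (n G₂) → Fin (suc m) → Fin (m + n G₂)
  section y₀ w with v ≟ w
  ... | yes _ = m ↑ʳ y₀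
  ... | no v≢w = punchOut v≢w ↑ˡ n G₂

  collapse∘section : ∀ y₀ w → collapse (section y₀ w) ≡ w
  collapse∘section y₀ w with v ≟ w
  ... | yes v≡w = trans (cong collapse⊎ (splitAt-↑ʳ m _ y₀)) v≡w
  ... | no v≢w = trans (cong collapse⊎ (splitAt-↑ˡ m _ _)) (punchIn-punchOut v≢w)

subst-isSubstitution : ∀ G₁ v G₂ → IsSubstitution (subst G₁ v G₂) G₁ G₂
subst-isSubstitution record { n = suc m ; adj = a ; sym = a-sym ; irrefl = a-irrefl } v G₂ = isSubstitution
  where open SubstitutionStructure a a-sym a-irrefl G₂ v

-- The outer graph is recovered by choosing one vertex of G₂ in place of v.
subst-embeddingˡ : ∀ G₁ v G₂ → Fin (n G₂) → Embedding G₁ (subst G₁ v G₂)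
subst-embeddingˡ record { n = suc m ; adj = a ; sym = a-sym ; irrefl = a-irrefl } v G₂ y₀ =
  section⇒embedding (IsSubstitution.collapsing isSubstitution) (section y₀) (collapse∘section y₀)
  where open SubstitutionStructure a a-sym a-irrefl G₂ v

weakShatterBound⇒VC≤ : ∀ {G d} → WeakShatterBound G d → VC≤ G d
weakShatterBound⇒VC≤ {G} = shatterBound⇒VC≤ {G} ∘ weakShatterBound⇒shatterBound {G}

VC≤⇒weakShatterBound : ∀ {G d} → VC≤ G d → WeakShatterBound G (suc d + suc d)
VC≤⇒weakShatterBound {G} = shatterBound⇒weakShatterBound {G} ∘ VC≤⇒shatterBound {G}

weakShatterBound-S : ∀ {F′ d} → (∀ G → F′ G → VC≤ G d) →
                     ∀ {G} → S F′ G → WeakShatterBound G (suc d + suc d)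
weakShatterBound-S bounded {G} (base F′G) = VC≤⇒weakShatterBound {G} (bounded G F′G)
weakShatterBound-S bounded (iso {G} {H} G≅H SG) =
  weakShatterBound-embedding (≅⇒embedding {H} {G} (≅-sym {G} {H} G≅H)) (weakShatterBound-S bounded SG)
weakShatterBound-S bounded (sub v SG₁ SG₂) =
  weakShatterBound-substitution (subst-isSubstitution _ v _)
    (weakShatterBound-S bounded SG₁) (weakShatterBound-S bounded SG₂)

NIP-S : ∀ F F′ → (∀ G → F G ⇔ S F′ G) → NIP F ⇔ NIP F′
NIP-S F F′ F≡SF′ = mk⇔
  (λ (d , bounded) → d , λ G F′G → bounded G (Equivalence.from (F≡SF′ G) (base F′G)))
  (λ (d , bounded) → suc d + suc d , λ G FG →
    weakShatterBound⇒VC≤ {G} (weakShatterBound-S bounded (Equivalence.to (F≡SF′ G) FG)))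

weakShatterBound-stable : ∀ {G d} → Stable (WeakShatterBound G d)
weakShatterBound-stable {d = d} ¬¬bound {k} e e-inj e-ws =
  decidable-stable (k ≤? d) λ k≰d → ¬¬bound λ bound → k≰d (bound e e-inj e-ws)

nonempty-inner : ∀ n₁ n₂ → n₁ < pred n₁ + n₂ → Fin n₂
nonempty-inner n₁ zero n₁<n₁-1 =
  contradiction (≤-trans (≤-reflexive (+-identityʳ (pred n₁))) pred[n]≤n) (<⇒≱ n₁<n₁-1)
nonempty-inner n₁ (suc n₂) _ = zero

NIP-prime : ∀ F → IsoClosed F → SubstClosed F → InducedClosed F → NIP F ⇔ NIP (λ G → F G × Prime G)
NIP-prime F iso-closed _ induced-closed = mk⇔
  (λ (d , bounded) → d , λ G (FG , _) → bounded G FG)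
  (λ (d , prime-bounded) → suc d + suc d , λ G FG →
    weakShatterBound⇒VC≤ {G} (weakShatterBound-F d prime-bounded G FG))
  where
  weakShatterBound-F : ∀ d → (∀ G → F G × Prime G → VC≤ G d) →
                       ∀ G → F G → WeakShatterBound G (suc d + suc d)
  weakShatterBound-F d prime-bounded = All.wfRec (On.wellFounded n <-wellFounded) _ _ step
    where
    D = suc d + suc d
    -- Prime G is a negation, so primality can only be decided under ¬¬,
    -- which the bound survives because k ≤ D is decidable.
    step : ∀ G → (∀ {G′} → n G′ < n G → F G′ → WeakShatterBound G′ D) → F G → WeakShatterBound G D
    step G smaller FG = weakShatterBound-stable {G} λ ¬bound →
      (λ prime → ¬bound (VC≤⇒weakShatterBound {G} (prime-bounded G (FG , prime))))
      λ (G₁ , v , G₂ , G₁<G , G₂<G , G≅H) → ¬bound (decomposed G₁ v G₂ G₁<G G₂<G G≅H)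
      where
      bound-embedded : ∀ {G′ H} → Embedding G′ H → F H → n G′ < n G → WeakShatterBound G′ D
      bound-embedded {G′} {H} f FH G′<G = weakShatterBound-embedding {G′} {induced H (n G′) map} f′
        (smaller G′<G (induced-closed H (n G′) map injective FH))
        where
        open Embedding f
        f′ : Embedding G′ (induced H (n G′) map)
        f′ = record { map = λ x → x ; injective = λ eq → eq ; adj-map = adj-map }
      decomposed : ∀ G₁ v G₂ → n G₁ < n G → n G₂ < n G → G ≅ subst G₁ v G₂ → WeakShatterBound G D
      decomposed G₁ v G₂ G₁<G G₂<G G≅H =
        weakShatterBound-embedding (≅⇒embedding {G} {subst G₁ v G₂} G≅H)
          (weakShatterBound-substitution (subst-isSubstitution G₁ v G₂)
            (bound-embedded (subst-embeddingˡ G₁ v G₂ y₀) FH G₁<G)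
            (bound-embedded (IsSubstitution.inner (subst-isSubstitution G₁ v G₂)) FH G₂<G))
        where
        FH : F (subst G₁ v G₂)
        FH = iso-closed G _ G≅H FG
        y₀ : Fin (n G₂)
        y₀ = nonempty-inner (n G₁) (n G₂) (≡.subst (n G₁ <_) (↔⇒≡ (proj₁ G≅H)) G₁<G)

theorem6p7 : (∀ (F F' : Family) → (∀ G → F G ⇔ S F' G) → NIP F ⇔ NIP F')
    × (∀ (F : Family) → IsoClosed F → SubstClosed F → InducedClosed F →
    NIP F ⇔ NIP (λ G → F G × Prime G))
theorem6p7 = NIP-S , NIP-prime
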